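{- Let $G$ be an $(n-3)$-regular graph of order $n\ge 4$. Then $\gamma_{\rm R}(G)=4$.
   Context: All graphs are finite, simple and undirected. A Roman dominating function on a graph $G=(V,E)$ is a function $f:V\to\{0,1,2\}$ such that every vertex $u$ with $f(u)=0$ is adjacent to at least one vertex $v$ with $f(v)=2$; its weight is $\sum_{u\in V}f(u)$. The Roman domination number $\gamma_{\rm R}(G)$ is the minimum weight of a Roman dominating function on $G$. -}

module Defs where

open import Data.Nat using (ℕ; _≤_; _+_; _∸_)
open import Data.Bool using (Bool; true; false; T)
open import Data.Fin using (Fin)
open import Data.List using (List; map; filter; length)
open import Data.Nat.ListAction using (sum)
open import Data.List.Base using (allFin)
open import Data.Product using (Σ; ∃; _×_; _,_)
open import Relation.Binary.PropositionalEquality using (_≡_)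
open import Relation.Nullary using (¬_)
open import Data.Bool.Properties using (T?)

record Graph (n : ℕ) : Set where
  field
    adj      : Fin n → Fin n → Bool
    symmetric : ∀ u v → adj u v ≡ adj v u
    irreflexive : ∀ u → adj u u ≡ false

open Graph public

Adj : ∀ {n} → Graph n → Fin n → Fin n → Set
Adj G u v = T (adj G u v)

degree : ∀ {n} → Graph n → Fin n → ℕ
degree {n} G v = length (filter (λ u → T? (adj G v u)) (allFin n))

IsRegular : ∀ {n} → Graph n → ℕ → Set
IsRegular G k = ∀ v → degree G v ≡ k

record RomanDominating {n : ℕ} (G : Graph n) (f : Fin n → ℕ) : Set where
  field
    bounded   : ∀ v → f v ≤ 2
    dominates : ∀ u → f u ≡ 0 → ∃ λ v → Adj G u v × f v ≡ 2

weight : ∀ {n} → (Fin n → ℕ) → ℕ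
weight {n} f = sum (map f (allFin n))

RomanDominationNumber : ∀ {n} → Graph n → ℕ → Set
RomanDominationNumber {n} G k =
  (Σ (Fin n → ℕ) λ f → RomanDominating G f × weight f ≡ k)
  × (∀ (f : Fin n → ℕ) → RomanDominating G f → k ≤ weight f)

-- In an (n − 3)-regular graph every vertex v has exactly three non-neighbours, v itself included,
-- so labelling v with 2 and its two other non-neighbours with 1 gives a Roman dominating function of
-- weight 4. Conversely, let f be Roman dominating. If no vertex is labelled 2, every vertex is
-- labelled at least 1 and the weight is at least n ≥ 4; if two vertices are labelled 2 the weight is
-- at least 4; and if v is the only vertex labelled 2, no non-neighbour of v can be labelled 0, so f
-- dominates the function above pointwise.
module Submission where

open import Defs
open import Data.Nat using (ℕ; zero; suc; _≤_; _+_; _*_; _∸_; z≤n; s≤s)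
open import Data.Nat.Properties
  using (≤-trans; ≤-reflexive; m≤m+n; m≤n+m; +-mono-≤; +-monoʳ-≤; *-identityʳ; m∸[m∸n]≡n)
import Data.Nat.Properties as ℕ
open import Data.Nat.ListAction using (sum)
open import Data.Bool using (Bool; true; false; T; not)
open import Data.Bool.Properties using (T?)
open import Data.Fin using (Fin; zero; suc; fromℕ<)
open import Data.Fin.Properties using (_≟_; any?)
open import Data.List using (List; []; _∷_; map; filter; length; allFin)
open import Data.List.Properties using (map-tabulate)
open import Data.Product using (∃; _×_; _,_)
open import Algebra.Properties.CommutativeSemigroup ℕ.+-commutativeSemigroup using (interchange)
open import Data.Empty using (⊥-elim)
open import Data.Unit using (tt)
open import Function using (_∘_; const; id)
open import Relation.Nullary using (¬_; Dec; does; yes; no; _×-dec_; ¬?)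
open import Relation.Nullary.Decidable using (dec-true; dec-false)
open import Relation.Binary.PropositionalEquality

indicator : Bool → ℕ
indicator true  = 1
indicator false = 0

length-filter-T? : ∀ {A : Set} (p : A → Bool) (xs : List A) →
  length (filter (T? ∘ p) xs) ≡ sum (map (indicator ∘ p) xs)
length-filter-T? p [] = refl
length-filter-T? p (x ∷ xs) with p x
... | true  = cong suc (length-filter-T? p xs)
... | false = length-filter-T? p xs


weight-suc : ∀ {n} (f : Fin (suc n) → ℕ) → weight f ≡ f zero + weight (f ∘ suc)
weight-suc f =
  cong (λ xs → f zero + sum xs) (trans (map-tabulate suc f) (sym (map-tabulate id (f ∘ suc))))

weight-cong : ∀ {n} {f g : Fin n → ℕ} → (∀ u → f u ≡ g u) → weight f ≡ weight g
weight-cong {zero}  f≗g = refl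
weight-cong {suc n} {f} {g} f≗g = begin
  weight f                   ≡⟨ weight-suc f ⟩
  f zero + weight (f ∘ suc)  ≡⟨ cong₂ _+_ (f≗g zero) (weight-cong (f≗g ∘ suc)) ⟩
  g zero + weight (g ∘ suc)  ≡⟨ weight-suc g ⟨
  weight g                   ∎
  where open ≡-Reasoning

weight-mono : ∀ {n} {f g : Fin n → ℕ} → (∀ u → f u ≤ g u) → weight f ≤ weight g
weight-mono {zero}  f≤g = z≤n
weight-mono {suc n} {f} {g} f≤g = begin
  weight f                   ≡⟨ weight-suc f ⟩
  f zero + weight (f ∘ suc)  ≤⟨ +-mono-≤ (f≤g zero) (weight-mono (f≤g ∘ suc)) ⟩
  g zero + weight (g ∘ suc)  ≡⟨ weight-suc g ⟨
  weight g                   ∎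
  where open ℕ.≤-Reasoning

weight-+ : ∀ {n} (f g : Fin n → ℕ) → weight (λ u → f u + g u) ≡ weight f + weight g
weight-+ {zero}  f g = refl
weight-+ {suc n} f g = begin
  weight (λ u → f u + g u)
    ≡⟨ weight-suc (λ u → f u + g u) ⟩
  f zero + g zero + weight (λ u → f (suc u) + g (suc u))
    ≡⟨ cong (f zero + g zero +_) (weight-+ (f ∘ suc) (g ∘ suc)) ⟩
  f zero + g zero + (weight (f ∘ suc) + weight (g ∘ suc))
    ≡⟨ interchange (f zero) (g zero) _ _ ⟩
  f zero + weight (f ∘ suc) + (g zero + weight (g ∘ suc))
    ≡⟨ cong₂ _+_ (weight-suc f) (weight-suc g) ⟨
  weight f + weight g ∎
  where open ≡-Reasoning

weight-const : ∀ n c → weight {n} (const c) ≡ n * c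
weight-const zero    c = refl
weight-const (suc n) c = trans (weight-suc {n} (const c)) (cong (c +_) (weight-const n c))

≤-weight : ∀ {n} (f : Fin n → ℕ) (a : Fin n) → f a ≤ weight f
≤-weight f zero    = ≤-trans (m≤m+n _ _) (≤-reflexive (sym (weight-suc f)))
≤-weight f (suc a) =
  ≤-trans (≤-trans (≤-weight (f ∘ suc) a) (m≤n+m _ (f zero))) (≤-reflexive (sym (weight-suc f)))

+-≤-weight : ∀ {n} (f : Fin n → ℕ) {a b : Fin n} → a ≢ b → f a + f b ≤ weight f
+-≤-weight f {zero}  {zero}  a≢b = ⊥-elim (a≢b refl)
+-≤-weight f {zero}  {suc b} a≢b =
  ≤-trans (+-monoʳ-≤ (f zero) (≤-weight (f ∘ suc) b)) (≤-reflexive (sym (weight-suc f)))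
+-≤-weight f {suc a} {zero}  a≢b =
  ≤-trans (≤-reflexive (ℕ.+-comm (f (suc a)) (f zero))) (+-≤-weight f {zero} {suc a} (a≢b ∘ sym))
+-≤-weight f {suc a} {suc b} a≢b =
  ≤-trans (+-≤-weight (f ∘ suc) (a≢b ∘ cong suc))
    (≤-trans (m≤n+m _ (f zero)) (≤-reflexive (sym (weight-suc f))))

weight-indicator-≟ : ∀ {n} (v : Fin n) → weight (λ u → indicator (does (u ≟ v))) ≡ 1
weight-indicator-≟ {suc n} zero    =
  trans (weight-suc {n} (λ u → indicator (does (u ≟ zero))))
        (cong suc (trans (weight-const n 0) (ℕ.*-zeroʳ n)))
weight-indicator-≟ {suc n} (suc v) =
  trans (weight-suc {n} (λ u → indicator (does (u ≟ suc v)))) (weight-indicator-≟ v)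

indicator≤1 : ∀ b → indicator b ≤ 1
indicator≤1 true  = s≤s z≤n
indicator≤1 false = z≤n

indicator+indicator-not : ∀ b → indicator b + indicator (not b) ≡ 1
indicator+indicator-not true  = refl
indicator+indicator-not false = refl

indicator-not≡0⇒T : ∀ {b} → indicator (not b) ≡ 0 → T b
indicator-not≡0⇒T {true} _ = tt

-- The number of non-neighbours of v, v itself included.
codegree : ∀ {n} → Graph n → Fin n → ℕ
codegree G v = weight (λ u → indicator (not (adj G v u)))

degree+codegree : ∀ {n} (G : Graph n) (v : Fin n) → degree G v + codegree G v ≡ n
degree+codegree {n} G v = begin
  degree G v + codegree G v
    ≡⟨ cong (_+ codegree G v) (length-filter-T? (adj G v) (allFin n)) ⟩
  weight (indicator ∘ adj G v) + codegree G v
    ≡⟨ weight-+ (indicator ∘ adj G v) (λ u → indicator (not (adj G v u))) ⟨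
  weight (λ u → indicator (adj G v u) + indicator (not (adj G v u)))
    ≡⟨ weight-cong (λ u → indicator+indicator-not (adj G v u)) ⟩
  weight {n} (const 1)
    ≡⟨ weight-const n 1 ⟩
  n * 1
    ≡⟨ *-identityʳ n ⟩
  n ∎
  where open ≡-Reasoning

codegree-regular : ∀ {n k} (G : Graph n) → IsRegular G k → ∀ v → codegree G v ≡ n ∸ k
codegree-regular {n} {k} G regular v = begin
  codegree G v                  ≡⟨ ℕ.m+n∸m≡n k (codegree G v) ⟨
  k + codegree G v ∸ k          ≡⟨ cong (λ d → d + codegree G v ∸ k) (regular v) ⟨
  degree G v + codegree G v ∸ k ≡⟨ cong (_∸ k) (degree+codegree G v) ⟩
  n ∸ k                         ∎
  where open ≡-Reasoning

-- 2 on v (which is its own non-neighbour), 1 on the other non-neighbours of v, 0 on its neighbours.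
romanStar : ∀ {n} → Graph n → Fin n → Fin n → ℕ
romanStar G v u = indicator (does (u ≟ v)) + indicator (not (adj G v u))

romanStar-centre : ∀ {n} (G : Graph n) (v : Fin n) → romanStar G v v ≡ 2
romanStar-centre G v rewrite dec-true (v ≟ v) refl | irreflexive G v = refl

romanStar-off-centre : ∀ {n} (G : Graph n) {u v : Fin n} → u ≢ v →
  romanStar G v u ≡ indicator (not (adj G v u))
romanStar-off-centre G {u} {v} u≢v =
  cong (λ b → indicator b + indicator (not (adj G v u))) (dec-false (u ≟ v) u≢v)

weight-romanStar : ∀ {n} (G : Graph n) (v : Fin n) → weight (romanStar G v) ≡ suc (codegree G v)
weight-romanStar G v =
  trans (weight-+ (λ u → indicator (does (u ≟ v))) (λ u → indicator (not (adj G v u))))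
        (cong (_+ codegree G v) (weight-indicator-≟ v))

romanStar-romanDominating : ∀ {n} (G : Graph n) (v : Fin n) → RomanDominating G (romanStar G v)
romanStar-romanDominating G v = record
  { bounded   = λ u → +-mono-≤ (indicator≤1 (does (u ≟ v))) (indicator≤1 (not (adj G v u)))
  ; dominates = λ u star≡0 →
      v , subst T (symmetric G v u) (indicator-not≡0⇒T (ℕ.m+n≡0⇒n≡0 _ star≡0)) , romanStar-centre G v
  }

module _ {n} {G : Graph n} {f : Fin n → ℕ} (rdf : RomanDominating G f) where
  open RomanDominating rdf

  romanDominating-without-2 : (∀ v → f v ≢ 2) → n ≤ weight f
  romanDominating-without-2 no-2 = begin
    n                    ≡⟨ *-identityʳ n ⟨
    n * 1                ≡⟨ weight-const n 1 ⟨
    weight {n} (const 1) ≤⟨ weight-mono positive ⟩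
    weight f             ∎
    where
    open ℕ.≤-Reasoning
    positive : ∀ u → 1 ≤ f u
    positive u with f u in fu
    ... | suc _ = s≤s z≤n
    ... | zero with (w , _ , fw≡2) ← dominates u fu = ⊥-elim (no-2 w fw≡2)

  romanStar≤ : ∀ {v} → f v ≡ 2 → ¬ (∃ λ w → w ≢ v × f w ≡ 2) → ∀ u → romanStar G v u ≤ f u
  romanStar≤ {v} fv≡2 no-other-2 u = by-cases (u ≟ v)
    where
    non-neighbour-bound : ∀ b → adj G v u ≡ b → indicator (not b) ≤ f u
    non-neighbour-bound true  _    = z≤n
    non-neighbour-bound false v≁u with f u in fu
    ... | suc _ = s≤s z≤n
    ... | zero with (w , u~w , fw≡2) ← dominates u fu = ⊥-elim (no-other-2 (w , w≢v , fw≡2))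
      where
      w≢v : w ≢ v
      w≢v refl = subst T v≁u (subst T (symmetric G u w) u~w)

    by-cases : Dec (u ≡ v) → romanStar G v u ≤ f u
    by-cases (yes refl) = ≤-reflexive (trans (romanStar-centre G u) (sym fv≡2))
    by-cases (no u≢v)   =
      ≤-trans (≤-reflexive (romanStar-off-centre G u≢v)) (non-neighbour-bound (adj G v u) refl)

  romanDominating-unique-2 : ∀ {v} → f v ≡ 2 → ¬ (∃ λ w → w ≢ v × f w ≡ 2) →
    suc (codegree G v) ≤ weight f
  romanDominating-unique-2 {v} fv≡2 no-other-2 =
    ≤-trans (≤-reflexive (sym (weight-romanStar G v))) (weight-mono (romanStar≤ fv≡2 no-other-2))

lemma2p4 : (n : ℕ) → 4 ≤ n → (G : Graph n) → IsRegular G (n ∸ 3) →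
    RomanDominationNumber G 4
lemma2p4 n 4≤n G regular = (romanStar G v₀ , romanStar-romanDominating G v₀ , weight≡4) , lower-bound
  where
  v₀ : Fin n
  v₀ = fromℕ< (≤-trans (s≤s z≤n) 4≤n)

  codegree≡3 : ∀ v → codegree G v ≡ 3
  codegree≡3 v = trans (codegree-regular G regular v) (m∸[m∸n]≡n (≤-trans (ℕ.n≤1+n 3) 4≤n))

  weight≡4 : weight (romanStar G v₀) ≡ 4
  weight≡4 = trans (weight-romanStar G v₀) (cong suc (codegree≡3 v₀))

  lower-bound : ∀ f → RomanDominating G f → 4 ≤ weight f
  lower-bound f rdf with any? (λ v → f v ℕ.≟ 2)
  ... | no no-2 = ≤-trans 4≤n (romanDominating-without-2 rdf (λ v fv≡2 → no-2 (v , fv≡2)))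
  ... | yes (v , fv≡2) with any? (λ w → ¬? (w ≟ v) ×-dec f w ℕ.≟ 2)
  ...   | yes (w , w≢v , fw≡2) = subst (_≤ weight f) (cong₂ _+_ fw≡2 fv≡2) (+-≤-weight f w≢v)
  ...   | no  no-other-2       =
    subst (_≤ weight f) (cong suc (codegree≡3 v)) (romanDominating-unique-2 rdf fv≡2 no-other-2)
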